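{- Let $\Gamma$ and $\Delta$ be multisets of nnf-formulas with $\Delta$ containing at most one formula. For every tree-like $\mathbf{LK_{nn}}$-proof $\pi$ of $\Gamma\Rightarrow\Delta$ there is a tree-like $G$-proof $\sigma_\pi$ of $\Gamma\Rightarrow\Delta$ with $|\sigma_\pi|\le|\pi|^{O(1)}$.
   Context: $\mathcal{L}_u$-formulas are built from atoms and constants $0,1$ by $\wedge,\vee,*,\to$; $\neg A:=A\to0$. An nnf-formula is generated by $F::=p\mid\neg p\mid F_1\wedge F_2\mid F_1\vee F_2$ ($p$ an atom); it is regarded as an $\mathcal{L}_u$-formula with $\neg p=p\to0$. $\mathbf{LK_{nn}}$ is the single-conclusion sequent calculus on nnf-formulas with axioms $p\Rightarrow p$, $\neg p\Rightarrow\neg p$, $p,\neg p\Rightarrow$, $\Rightarrow p\vee\neg p$ ($p$ an atom), the structural rules of $\mathbf{LJ}$ (left weakening, right weakening into an empty succedent, left contraction, cut) and the $\mathbf{LJ}$ rules for $\wedge$ and $\vee$ (from $\Gamma,A_i\Rightarrow\Delta$ infer $\Gamma,A_0\wedge A_1\Rightarrow\Delta$; from $\Gamma\Rightarrow A$ and $\Gamma\Rightarrow B$ infer $\Gamma\Rightarrow A\wedge B$; from $\Gamma,A\Rightarrow\Delta$ and $\Gamma,B\Rightarrow\Delta$ infer $\Gamma,A\vee B\Rightarrow\Delta$; from $\Gamma\Rightarrow A_i$ infer $\Gamma\Rightarrow A_0\vee A_1$). $\mathbf{FL_e}$ is the single-conclusion sequent calculus (sequents $\Gamma\Rightarrow\Delta$,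 finite multisets, $|\Delta|\le1$) with axioms $A\Rightarrow A$, $\Rightarrow1$, $0\Rightarrow$ and rules: from $\Gamma\Rightarrow\Delta$ infer $\Gamma,1\Rightarrow\Delta$; from $\Gamma\Rightarrow$ infer $\Gamma\Rightarrow0$; the $\wedge,\vee$ rules above; from $\Gamma,A,B\Rightarrow\Delta$ infer $\Gamma,A*B\Rightarrow\Delta$; from $\Gamma\Rightarrow A$ and $\Sigma\Rightarrow B$ infer $\Gamma,\Sigma\Rightarrow A*B$; from $\Gamma\Rightarrow A$ and $\Sigma,B\Rightarrow\Lambda$ infer $\Gamma,\Sigma,A\to B\Rightarrow\Lambda$; from $\Gamma,A\Rightarrow B$ infer $\Gamma\Rightarrow A\to B$; cut: from $\Gamma\Rightarrow A$ and $\Sigma,A\Rightarrow\Lambda$ infer $\Gamma,\Sigma\Rightarrow\Lambda$. $G$ is $\mathbf{FL_e}$ plus the additional initial sequents, for every atom $p$: $\Rightarrow p\vee\neg p$, $p\Rightarrow1$, $\neg p\Rightarrow1$, $0\Rightarrow p$, $0\Rightarrow\neg p$, and $0\Rightarrow0*0$ (only for atoms; no substitution instances). A proof is tree-like if every sequent occurrence is used at most once as a premise. Size = number of symbols. -}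

module Defs where

open import Data.Nat using (ℕ; zero; suc; _+_)
open import Data.List using (List; []; _∷_; _++_; map)
open import Data.Maybe using (Maybe; just; nothing)
import Data.Maybe as Maybe
open import Data.List.Relation.Binary.Permutation.Propositional using (_↭_)

infixr 6 _⊓_ _⊔_
infixr 7 _⊗_
infixr 5 _⟶_

data Fm : Set where
  var     : ℕ → Fm
  𝟘 𝟙     : Fm
  _⊓_ _⊔_ : Fm → Fm → Fm
  _⊗_     : Fm → Fm → Fm
  _⟶_     : Fm → Fm → Fm

∼_ : Fm → Fm
∼ A = A ⟶ 𝟘

fsize : Fm → ℕ
fsize (var _) = 1
fsize 𝟘 = 1
fsize 𝟙 = 1
fsize (A ⊓ B) = suc (fsize A + fsize B)
fsize (A ⊔ B) = suc (fsize A + fsize B)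
fsize (A ⊗ B) = suc (fsize A + fsize B)
fsize (A ⟶ B) = suc (fsize A + fsize B)

infixr 6 _∧ₙ_ _∨ₙ_

data NNF : Set where
  pos neg       : ℕ → NNF
  _∧ₙ_ _∨ₙ_     : NNF → NNF → NNF

⟦_⟧ : NNF → Fm
⟦ pos p ⟧ = var p
⟦ neg p ⟧ = ∼ var p
⟦ A ∧ₙ B ⟧ = ⟦ A ⟧ ⊓ ⟦ B ⟧
⟦ A ∨ₙ B ⟧ = ⟦ A ⟧ ⊔ ⟦ B ⟧

-- Sequent sizes: symbols of all formulas plus the sequent arrow

lsize : List Fm → ℕ
lsize [] = 0
lsize (A ∷ Γ) = fsize A + lsize Γ

msize : Maybe Fm → ℕ
msize nothing = 0
msize (just A) = fsize A

seqSize : List Fm → Maybe Fm → ℕ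
seqSize Γ Δ = suc (lsize Γ + msize Δ)

nseqSize : List NNF → Maybe NNF → ℕ
nseqSize Γ Δ = seqSize (map ⟦_⟧ Γ) (Maybe.map ⟦_⟧ Δ)

-- Tree-like LK_nn proofs.  Antecedents are multisets, represented by
-- lists up to permutation: each rule's conclusion may be any permutation
-- of the displayed antecedent.

data LK : List NNF → Maybe NNF → Set where
  ax-p   : ∀ p → LK (pos p ∷ []) (just (pos p))
  ax-n   : ∀ p → LK (neg p ∷ []) (just (neg p))
  ax-pn  : ∀ {Γ} p → Γ ↭ pos p ∷ neg p ∷ [] → LK Γ nothing
  ax-em  : ∀ p → LK [] (just (pos p ∨ₙ neg p))
  wL     : ∀ {Γ Σ Δ} A → LK Σ Δ → Γ ↭ A ∷ Σ → LK Γ Δ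
  wR     : ∀ {Γ} A → LK Γ nothing → LK Γ (just A)
  cL     : ∀ {Γ Σ Δ} A → LK (A ∷ A ∷ Σ) Δ → Γ ↭ A ∷ Σ → LK Γ Δ
  cut    : ∀ {Γ Γ₁ Σ Δ} A → LK Γ₁ (just A) → LK (A ∷ Σ) Δ → Γ ↭ Γ₁ ++ Σ → LK Γ Δ
  ∧L₁    : ∀ {Γ Σ Δ} A B → LK (A ∷ Σ) Δ → Γ ↭ (A ∧ₙ B) ∷ Σ → LK Γ Δ
  ∧L₂    : ∀ {Γ Σ Δ} A B → LK (B ∷ Σ) Δ → Γ ↭ (A ∧ₙ B) ∷ Σ → LK Γ Δ
  ∧R     : ∀ {Γ} A B → LK Γ (just A) → LK Γ (just B) → LK Γ (just (A ∧ₙ B))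
  ∨L     : ∀ {Γ Σ Δ} A B → LK (A ∷ Σ) Δ → LK (B ∷ Σ) Δ → Γ ↭ (A ∨ₙ B) ∷ Σ → LK Γ Δ
  ∨R₁    : ∀ {Γ} A B → LK Γ (just A) → LK Γ (just (A ∨ₙ B))
  ∨R₂    : ∀ {Γ} A B → LK Γ (just B) → LK Γ (just (A ∨ₙ B))

lkSize : ∀ {Γ Δ} → LK Γ Δ → ℕ
lkSize {Γ} {Δ} (ax-p p) = nseqSize Γ Δ
lkSize {Γ} {Δ} (ax-n p) = nseqSize Γ Δ
lkSize {Γ} {Δ} (ax-pn p _) = nseqSize Γ Δ
lkSize {Γ} {Δ} (ax-em p) = nseqSize Γ Δ
lkSize {Γ} {Δ} (wL A π _) = nseqSize Γ Δ + lkSize π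
lkSize {Γ} {Δ} (wR A π) = nseqSize Γ Δ + lkSize π
lkSize {Γ} {Δ} (cL A π _) = nseqSize Γ Δ + lkSize π
lkSize {Γ} {Δ} (cut A π ρ _) = nseqSize Γ Δ + (lkSize π + lkSize ρ)
lkSize {Γ} {Δ} (∧L₁ A B π _) = nseqSize Γ Δ + lkSize π
lkSize {Γ} {Δ} (∧L₂ A B π _) = nseqSize Γ Δ + lkSize π
lkSize {Γ} {Δ} (∧R A B π ρ) = nseqSize Γ Δ + (lkSize π + lkSize ρ)
lkSize {Γ} {Δ} (∨L A B π ρ _) = nseqSize Γ Δ + (lkSize π + lkSize ρ)
lkSize {Γ} {Δ} (∨R₁ A B π) = nseqSize Γ Δ + lkSize π
lkSize {Γ} {Δ} (∨R₂ A B π) = nseqSize Γ Δ + lkSize π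

-- Tree-like proofs in G = FL_e + extra initial sequents (atoms only)

data G : List Fm → Maybe Fm → Set where
  ax     : ∀ A → G (A ∷ []) (just A)
  ax1    : G [] (just 𝟙)
  ax0    : G (𝟘 ∷ []) nothing
  oneL     : ∀ {Γ Σ Δ} → G Σ Δ → Γ ↭ 𝟙 ∷ Σ → G Γ Δ
  zeroR     : ∀ {Γ} → G Γ nothing → G Γ (just 𝟘)
  ∧L₁    : ∀ {Γ Σ Δ} A B → G (A ∷ Σ) Δ → Γ ↭ (A ⊓ B) ∷ Σ → G Γ Δ
  ∧L₂    : ∀ {Γ Σ Δ} A B → G (B ∷ Σ) Δ → Γ ↭ (A ⊓ B) ∷ Σ → G Γ Δ
  ∧R     : ∀ {Γ} A B → G Γ (just A) → G Γ (just B) → G Γ (just (A ⊓ B))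
  ∨L     : ∀ {Γ Σ Δ} A B → G (A ∷ Σ) Δ → G (B ∷ Σ) Δ → Γ ↭ (A ⊔ B) ∷ Σ → G Γ Δ
  ∨R₁    : ∀ {Γ} A B → G Γ (just A) → G Γ (just (A ⊔ B))
  ∨R₂    : ∀ {Γ} A B → G Γ (just B) → G Γ (just (A ⊔ B))
  *L     : ∀ {Γ Σ Δ} A B → G (A ∷ B ∷ Σ) Δ → Γ ↭ (A ⊗ B) ∷ Σ → G Γ Δ
  *R     : ∀ {Γ Γ₁ Σ} A B → G Γ₁ (just A) → G Σ (just B) → Γ ↭ Γ₁ ++ Σ → G Γ (just (A ⊗ B))
  →L     : ∀ {Γ Γ₁ Σ Λ} A B → G Γ₁ (just A) → G (B ∷ Σ) Λ → Γ ↭ (A ⟶ B) ∷ (Γ₁ ++ Σ) → G Γ Λ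
  →R     : ∀ {Γ} A B → G (A ∷ Γ) (just B) → G Γ (just (A ⟶ B))
  cut    : ∀ {Γ Γ₁ Σ Λ} A → G Γ₁ (just A) → G (A ∷ Σ) Λ → Γ ↭ Γ₁ ++ Σ → G Γ Λ
  -- additional initial sequents, for atoms p only
  em     : ∀ p → G [] (just (var p ⊔ ∼ var p))
  p1     : ∀ p → G (var p ∷ []) (just 𝟙)
  np1    : ∀ p → G (∼ var p ∷ []) (just 𝟙)
  zp     : ∀ p → G (𝟘 ∷ []) (just (var p))
  znp    : ∀ p → G (𝟘 ∷ []) (just (∼ var p))
  zzz    : G (𝟘 ∷ []) (just (𝟘 ⊗ 𝟘))

gSize : ∀ {Γ Δ} → G Γ Δ → ℕ
gSize {Γ} {Δ} (ax A) = seqSize Γ Δ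
gSize {Γ} {Δ} ax1 = seqSize Γ Δ
gSize {Γ} {Δ} ax0 = seqSize Γ Δ
gSize {Γ} {Δ} (oneL σ _) = seqSize Γ Δ + gSize σ
gSize {Γ} {Δ} (zeroR σ) = seqSize Γ Δ + gSize σ
gSize {Γ} {Δ} (∧L₁ A B σ _) = seqSize Γ Δ + gSize σ
gSize {Γ} {Δ} (∧L₂ A B σ _) = seqSize Γ Δ + gSize σ
gSize {Γ} {Δ} (∧R A B σ τ) = seqSize Γ Δ + (gSize σ + gSize τ)
gSize {Γ} {Δ} (∨L A B σ τ _) = seqSize Γ Δ + (gSize σ + gSize τ)
gSize {Γ} {Δ} (∨R₁ A B σ) = seqSize Γ Δ + gSize σ
gSize {Γ} {Δ} (∨R₂ A B σ) = seqSize Γ Δ + gSize σ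
gSize {Γ} {Δ} (*L A B σ _) = seqSize Γ Δ + gSize σ
gSize {Γ} {Δ} (*R A B σ τ _) = seqSize Γ Δ + (gSize σ + gSize τ)
gSize {Γ} {Δ} (→L A B σ τ _) = seqSize Γ Δ + (gSize σ + gSize τ)
gSize {Γ} {Δ} (→R A B σ) = seqSize Γ Δ + gSize σ
gSize {Γ} {Δ} (cut A σ τ _) = seqSize Γ Δ + (gSize σ + gSize τ)
gSize {Γ} {Δ} (em p) = seqSize Γ Δ
gSize {Γ} {Δ} (p1 p) = seqSize Γ Δ
gSize {Γ} {Δ} (np1 p) = seqSize Γ Δ
gSize {Γ} {Δ} (zp p) = seqSize Γ Δ
gSize {Γ} {Δ} (znp p) = seqSize Γ Δ
gSize {Γ} {Δ} zzz = seqSize Γ Δ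

{-# OPTIONS --safe #-}
module Submission where

-- Every LK_nn rule except weakening and contraction is a rule of G (the clash axiom p, ¬p ⇒
-- is an instance of →L).  For an nnf-formula A, weakening is a cut with a derivation of
-- A ⇒ 1 (from p ⇒ 1 and ¬p ⇒ 1) or of 0 ⇒ A (from 0 ⇒ p and 0 ⇒ ¬p).  Contraction is a
-- cut with A ⇒ A * A, proved by cases on ⇒ A ∨ Ā, where Ā is the De Morgan dual of A and
-- this excluded middle is built up from ⇒ p ∨ ¬p.  If A holds, A, A ⇒ A * A; if Ā holds,
-- A, Ā ⇒ 0 and 0 ⇒ 0 * 0 ⇒ A * A.  These auxiliary derivations have size O(|A|³), so each
-- step of π costs O(|π|³) in G and the whole translation O(|π|⁴).

open import Defs
open import Algebra.Properties.CommutativeSemigroup using (interchange)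
open import Data.Bool using (T)
open import Data.List using (List; []; _∷_; _++_; map)
open import Data.List.Properties using (map-++; ++-identityʳ)
open import Data.List.Relation.Binary.Permutation.Propositional
  using (_↭_; refl; swap; trans; ↭-reflexive)
open import Data.List.Relation.Binary.Permutation.Propositional.Properties using (map⁺)
open import Data.Maybe using (just; nothing)
import Data.Maybe as Maybe
open import Data.Nat using (ℕ; suc; _+_; _*_; _^_; _≤_; z≤n; s≤s; _≤ᵇ_; >-nonZero)
open import Data.Nat.ListAction using (sum)
open import Data.Nat.ListAction.Properties using (sum-↭)
open import Data.Nat.Properties
open import Data.Nat.Tactic.RingSolver using (solve)
open import Data.Product using (Σ; _,_)
open import Relation.Binary.PropositionalEquality as ≡ using (_≡_; sym; cong; cong₂)

dual : NNF → NNF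
dual (pos p) = neg p
dual (neg p) = pos p
dual (A ∧ₙ B) = dual A ∨ₙ dual B
dual (A ∨ₙ B) = dual A ∧ₙ dual B

discard : (A : NNF) → G (⟦ A ⟧ ∷ []) (just 𝟙)
discard (pos p) = p1 p
discard (neg p) = np1 p
discard (A ∧ₙ B) = ∧L₁ _ _ (discard A) refl
discard (A ∨ₙ B) = ∨L _ _ (discard A) (discard B) refl

explode : (A : NNF) → G (𝟘 ∷ []) (just ⟦ A ⟧)
explode (pos p) = zp p
explode (neg p) = znp p
explode (A ∧ₙ B) = ∧R _ _ (explode A) (explode B)
explode (A ∨ₙ B) = ∨R₁ _ _ (explode A)

weaken : ∀ {Γ Σ Δ} X → G Σ Δ → Γ ↭ ⟦ X ⟧ ∷ Σ → G Γ Δ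
weaken X σ q = cut 𝟙 (discard X) (oneL σ refl) q

refute : (A : NNF) → ∀ {Γ} → Γ ↭ ⟦ A ⟧ ∷ ⟦ dual A ⟧ ∷ [] → G Γ nothing
refute (pos p) q = →L _ _ (ax _) ax0 (trans q (swap _ _ refl))
refute (neg p) q = →L _ _ (ax _) ax0 q
refute (A ∧ₙ B) q =
  ∨L _ _ (∧L₁ _ _ (refute A refl) (swap _ _ refl)) (∧L₂ _ _ (refute B refl) (swap _ _ refl))
     (trans q (swap _ _ refl))
refute (A ∨ₙ B) q =
  ∨L _ _ (∧L₁ _ _ (refute A (swap _ _ refl)) (swap _ _ refl))
     (∧L₂ _ _ (refute B (swap _ _ refl)) (swap _ _ refl)) q

∨-comm : ∀ {X Y} → G [] (just (X ⊔ Y)) → G [] (just (Y ⊔ X))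
∨-comm σ = cut _ σ (∨L _ _ (∨R₂ _ _ (ax _)) (∨R₁ _ _ (ax _)) refl) refl

distrib : ∀ A A′ B B′ → G [] (just ⟦ A ∨ₙ A′ ⟧) → G [] (just ⟦ B ∨ₙ B′ ⟧) →
          G [] (just ⟦ (A ∧ₙ B) ∨ₙ (A′ ∨ₙ B′) ⟧)
distrib A A′ B B′ σ τ = cut _ σ (cut _ τ (∨L _ _ fromB fromB′ refl) refl) refl
  where
  fromB : G (⟦ B ⟧ ∷ ⟦ A ∨ₙ A′ ⟧ ∷ []) (just ⟦ (A ∧ₙ B) ∨ₙ (A′ ∨ₙ B′) ⟧)
  fromB = ∨L _ _
    (∨R₁ _ _ (∧R _ _ (weaken B (ax _) (swap _ _ refl)) (weaken A (ax _) refl)))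
    (weaken B (∨R₂ _ _ (∨R₁ _ _ (ax _))) (swap _ _ refl))
    (swap _ _ refl)
  fromB′ : G (⟦ B′ ⟧ ∷ ⟦ A ∨ₙ A′ ⟧ ∷ []) (just ⟦ (A ∧ₙ B) ∨ₙ (A′ ∨ₙ B′) ⟧)
  fromB′ = weaken (A ∨ₙ A′) (∨R₂ _ _ (∨R₂ _ _ (ax _))) (swap _ _ refl)

excludedMiddle : (A : NNF) → G [] (just ⟦ A ∨ₙ dual A ⟧)
excludedMiddle (pos p) = em p
excludedMiddle (neg p) = ∨-comm (em p)
excludedMiddle (A ∧ₙ B) = distrib A (dual A) B (dual B) (excludedMiddle A) (excludedMiddle B)
excludedMiddle (A ∨ₙ B) =
  ∨-comm (distrib (dual A) A (dual B) B (∨-comm (excludedMiddle A)) (∨-comm (excludedMiddle B)))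

duplicate : (A : NNF) → G (⟦ A ⟧ ∷ []) (just (⟦ A ⟧ ⊗ ⟦ A ⟧))
duplicate A = cut _ (excludedMiddle A) (∨L _ _ (*R _ _ (ax _) (ax _) refl) fromDual refl) refl
  where
  fromDual : G (⟦ dual A ⟧ ∷ ⟦ A ⟧ ∷ []) (just (⟦ A ⟧ ⊗ ⟦ A ⟧))
  fromDual = cut 𝟘 (zeroR (refute A (swap _ _ refl)))
    (cut (𝟘 ⊗ 𝟘) zzz (*L _ _ (*R _ _ (explode A) (explode A) refl) refl) refl) refl

translate : ∀ {Γ Δ} → LK Γ Δ → G (map ⟦_⟧ Γ) (Maybe.map ⟦_⟧ Δ)
translate (ax-p p) = ax _
translate (ax-n p) = ax _
translate (ax-pn p q) = →L _ _ (ax _) ax0 (trans (map⁺ ⟦_⟧ q) (swap _ _ refl))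
translate (ax-em p) = em p
translate (wL A π q) = weaken A (translate π) (map⁺ ⟦_⟧ q)
translate (wR A π) = cut 𝟘 (zeroR (translate π)) (explode A) (↭-reflexive (sym (++-identityʳ _)))
translate (cL A π q) = cut _ (duplicate A) (*L _ _ (translate π) refl) (map⁺ ⟦_⟧ q)
translate (cut {Γ₁ = Γ₁} {Σ = Σ′} A π ρ q) =
  cut _ (translate π) (translate ρ) (trans (map⁺ ⟦_⟧ q) (↭-reflexive (map-++ ⟦_⟧ Γ₁ Σ′)))
translate (∧L₁ A B π q) = ∧L₁ _ _ (translate π) (map⁺ ⟦_⟧ q)
translate (∧L₂ A B π q) = ∧L₂ _ _ (translate π) (map⁺ ⟦_⟧ q)
translate (∧R A B π ρ) = ∧R _ _ (translate π) (translate ρ)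
translate (∨L A B π ρ q) = ∨L _ _ (translate π) (translate ρ) (map⁺ ⟦_⟧ q)
translate (∨R₁ A B π) = ∨R₁ _ _ (translate π)
translate (∨R₂ A B π) = ∨R₂ _ _ (translate π)

size : NNF → ℕ
size A = fsize ⟦ A ⟧

1≤fsize : ∀ F → 1 ≤ fsize F
1≤fsize (var _) = s≤s z≤n
1≤fsize 𝟘 = s≤s z≤n
1≤fsize 𝟙 = s≤s z≤n
1≤fsize (_ ⊓ _) = s≤s z≤n
1≤fsize (_ ⊔ _) = s≤s z≤n
1≤fsize (_ ⊗ _) = s≤s z≤n
1≤fsize (_ ⟶ _) = s≤s z≤n

left≤ : ∀ {a b M} → suc (a + b) ≤ M → a ≤ M
left≤ {a} h = m+n≤o⇒m≤o a (<⇒≤ h)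

right≤ : ∀ {a b M} → suc (a + b) ≤ M → b ≤ M
right≤ {a} h = m+n≤o⇒n≤o a (<⇒≤ h)

suc-+-≤-3* : ∀ {x y} a b → x ≤ 3 * a → y ≤ 3 * b → suc (x + y) ≤ 3 * suc (a + b)
suc-+-≤-3* {x} {y} a b hx hy = begin
  suc (x + y)           ≤⟨ s≤s (+-mono-≤ hx hy) ⟩
  suc (3 * a + 3 * b)   ≡⟨ cong suc (sym (*-distribˡ-+ 3 a b)) ⟩
  suc (3 * (a + b))     ≤⟨ m≤n+m _ 2 ⟩
  3 + 3 * (a + b)       ≡⟨ sym (*-suc 3 (a + b)) ⟩
  3 * suc (a + b)       ∎
  where open ≤-Reasoning

size-dual≤ : ∀ A → size (dual A) ≤ 3 * size A
size-dual≤ (pos p) = ≤-refl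
size-dual≤ (neg p) = s≤s z≤n
size-dual≤ (A ∧ₙ B) = suc-+-≤-3* (size A) (size B) (size-dual≤ A) (size-dual≤ B)
size-dual≤ (A ∨ₙ B) = suc-+-≤-3* (size A) (size B) (size-dual≤ A) (size-dual≤ B)

lsize≡sum : ∀ Γ → lsize Γ ≡ sum (map fsize Γ)
lsize≡sum [] = ≡.refl
lsize≡sum (F ∷ Γ) = cong (fsize F +_) (lsize≡sum Γ)

lsize-↭ : ∀ {Γ Γ′} → Γ ↭ Γ′ → lsize Γ ≡ lsize Γ′
lsize-↭ {Γ} {Γ′} p = begin
  lsize Γ              ≡⟨ lsize≡sum Γ ⟩
  sum (map fsize Γ)    ≡⟨ sum-↭ (map⁺ fsize p) ⟩
  sum (map fsize Γ′)   ≡⟨ sym (lsize≡sum Γ′) ⟩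
  lsize Γ′             ∎
  where open ≡.≡-Reasoning

seqSize-↭ : ∀ {Γ Γ′} Δ → Γ ↭ Γ′ → seqSize Γ Δ ≡ seqSize Γ′ Δ
seqSize-↭ Δ p = cong (λ l → suc (l + msize Δ)) (lsize-↭ p)

seqSize-⊗ : ∀ X Y Γ Δ → seqSize (X ⊗ Y ∷ Γ) Δ ≡ suc (seqSize (X ∷ Y ∷ Γ) Δ)
seqSize-⊗ X Y Γ Δ = cong (λ l → suc (suc (l + msize Δ))) (+-assoc (fsize X) (fsize Y) (lsize Γ))

seqSize-𝟙 : ∀ {Γ Σ F} Δ → Γ ↭ F ∷ Σ → seqSize (𝟙 ∷ Σ) Δ ≤ seqSize Γ Δ
seqSize-𝟙 {Γ} {Σ} {F} Δ p = begin
  seqSize (𝟙 ∷ Σ) Δ   ≤⟨ s≤s (+-monoˡ-≤ (msize Δ) (+-monoˡ-≤ (lsize Σ) (1≤fsize F))) ⟩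
  seqSize (F ∷ Σ) Δ   ≡⟨ sym (seqSize-↭ Δ p) ⟩
  seqSize Γ Δ         ∎
  where open ≤-Reasoning

seqSize-𝟘 : ∀ Γ F → seqSize Γ (just 𝟘) ≤ seqSize Γ (just F)
seqSize-𝟘 Γ F = s≤s (+-monoʳ-≤ (lsize Γ) (1≤fsize F))

fsize≤seqSizeˡ : ∀ {Γ Σ F} Δ → Γ ↭ F ∷ Σ → fsize F ≤ seqSize Γ Δ
fsize≤seqSizeˡ {Γ} {Σ} {F} Δ p = begin
  fsize F              ≤⟨ m≤m+n (fsize F) (lsize Σ) ⟩
  lsize (F ∷ Σ)        ≡⟨ sym (lsize-↭ p) ⟩
  lsize Γ              ≤⟨ m≤m+n (lsize Γ) (msize Δ) ⟩
  lsize Γ + msize Δ    <⟨ ≤-refl ⟩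
  seqSize Γ Δ          ∎
  where open ≤-Reasoning

fsize≤seqSizeʳ : ∀ Γ F → fsize F ≤ seqSize Γ (just F)
fsize≤seqSizeʳ Γ F = m≤n⇒m≤1+n (m≤n+m (fsize F) (lsize Γ))

nseqSize≤lkSize : ∀ {Γ Δ} (π : LK Γ Δ) → nseqSize Γ Δ ≤ lkSize π
nseqSize≤lkSize (ax-p p) = ≤-refl
nseqSize≤lkSize (ax-n p) = ≤-refl
nseqSize≤lkSize (ax-pn p _) = ≤-refl
nseqSize≤lkSize (ax-em p) = ≤-refl
nseqSize≤lkSize (wL _ _ _) = m≤m+n _ _
nseqSize≤lkSize (wR _ _) = m≤m+n _ _
nseqSize≤lkSize (cL _ _ _) = m≤m+n _ _
nseqSize≤lkSize (cut _ _ _ _) = m≤m+n _ _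
nseqSize≤lkSize (∧L₁ _ _ _ _) = m≤m+n _ _
nseqSize≤lkSize (∧L₂ _ _ _ _) = m≤m+n _ _
nseqSize≤lkSize (∧R _ _ _ _) = m≤m+n _ _
nseqSize≤lkSize (∨L _ _ _ _ _) = m≤m+n _ _
nseqSize≤lkSize (∨R₁ _ _ _) = m≤m+n _ _
nseqSize≤lkSize (∨R₂ _ _ _) = m≤m+n _ _

decide≤ : ∀ {m n} {_ : T (m ≤ᵇ n)} → m ≤ n
decide≤ {m} {n} {m≤ᵇn} = ≤ᵇ⇒≤ m n m≤ᵇn

M≤M*M : ∀ {M} → 1 ≤ M → M ≤ M * M
M≤M*M {M} 1≤M = m≤m*n M M {{>-nonZero 1≤M}}

*-≤-square : ∀ K {a M} → a ≤ M → K * a * M ≤ K * (M * M)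
*-≤-square K {a} {M} h = ≤-trans (*-monoˡ-≤ M (*-monoʳ-≤ K h)) (≤-reflexive (*-assoc K M M))

*-distrib-+-scaled : ∀ K a b U → K * a * U + K * b * U ≡ K * (a + b) * U
*-distrib-+-scaled K a b U = begin
  K * a * U + K * b * U   ≡⟨ sym (*-distribʳ-+ U (K * a) (K * b)) ⟩
  (K * a + K * b) * U     ≡⟨ cong (_* U) (sym (*-distribˡ-+ K a b)) ⟩
  K * (a + b) * U         ∎
  where open ≡.≡-Reasoning

quartic≤power : ∀ K L → 1 ≤ L → 4 ≤ K → K * L * (L * (L * L)) ≤ K * L ^ K
quartic≤power K L 1≤L 4≤K = begin
  K * L * (L * (L * L))   ≡⟨ *-assoc K L (L * (L * L)) ⟩
  K * (L * (L * (L * L))) ≡⟨ cong (λ t → K * (L * (L * (L * t)))) (sym (*-identityʳ L)) ⟩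
  K * L ^ 4               ≤⟨ *-monoʳ-≤ K (^-monoʳ-≤ L {{>-nonZero 1≤L}} 4≤K) ⟩
  K * L ^ K               ∎
  where open ≤-Reasoning

-- Unlike `sum`, ∑ has no trailing `+ 0`, so a one-element residual is definitionally itself.
∑ : List ℕ → ℕ
∑ [] = 0
∑ (a ∷ []) = a
∑ (a ∷ R@(_ ∷ _)) = a + ∑ R

∑-++ : ∀ R S → ∑ (R ++ S) ≡ ∑ R + ∑ S
∑-++ [] S = ≡.refl
∑-++ (a ∷ []) [] = sym (+-identityʳ a)
∑-++ (a ∷ []) (_ ∷ _) = ≡.refl
∑-++ (a ∷ b ∷ R) S = ≡.trans (cong (a +_) (∑-++ (b ∷ R) S)) (sym (+-assoc a _ _))

-- A budget x ≤ C ·U+Σ R measures the sequents of a fixed derivation pattern in a unit U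
-- bounding each of them, and keeps the sizes R of embedded subderivations apart.  Budgets
-- are assembled along the shape of gSize, so C is a numeral and decide≤ compares it.
module Budget (U : ℕ) (1≤U : 1 ≤ U) where

  infix 4 _≤_·U+Σ_
  infixr 5 _⊕_ _▹_

  record _≤_·U+Σ_ (x C : ℕ) (R : List ℕ) : Set where
    constructor within
    field bound : x ≤ C * U + ∑ R

  free : 0 ≤ 0 ·U+Σ []
  free = within z≤n

  units : ∀ {x C} → x ≤ C * U → x ≤ C ·U+Σ []
  units h = within (≤-trans h (m≤m+n _ 0))

  unit : ∀ {x} → x ≤ U → x ≤ 1 ·U+Σ []
  unit h = units (≤-trans h (≤-reflexive (sym (*-identityˡ U))))

  one : 1 ≤ 1 ·U+Σ []
  one = unit 1≤U

  residual : ∀ {x r} → x ≤ r → x ≤ 0 ·U+Σ (r ∷ [])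
  residual = within

  cast : ∀ {x y C R} → x ≡ y → y ≤ C ·U+Σ R → x ≤ C ·U+Σ R
  cast ≡.refl b = b

  _⊕_ : ∀ {x y C D R S} → x ≤ C ·U+Σ R → y ≤ D ·U+Σ S → x + y ≤ C + D ·U+Σ R ++ S
  _⊕_ {x} {y} {C} {D} {R} {S} (within h) (within k) = within (begin
    x + y                             ≤⟨ +-mono-≤ h k ⟩
    (C * U + ∑ R) + (D * U + ∑ S)     ≡⟨ interchange +-commutativeSemigroup (C * U) (∑ R) (D * U) (∑ S) ⟩
    (C * U + D * U) + (∑ R + ∑ S)     ≡⟨ cong₂ _+_ (sym (*-distribʳ-+ U C D)) (sym (∑-++ R S)) ⟩
    (C + D) * U + ∑ (R ++ S)          ∎)
    where open ≤-Reasoning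

  suc⊕ : ∀ {x C R} → x ≤ C ·U+Σ R → suc x ≤ suc C ·U+Σ R
  suc⊕ {C = C} {R} (within h) =
    within (≤-trans (+-mono-≤ 1≤U h) (≤-reflexive (sym (+-assoc U (C * U) (∑ R)))))

  sequent : ∀ {x y C D} → x ≤ C ·U+Σ [] → y ≤ D ·U+Σ [] → suc (x + y) ≤ suc (C + D) ·U+Σ []
  sequent hΓ hΔ = suc⊕ (hΓ ⊕ hΔ)

  _▹_ : ∀ {x r C D R} → x ≤ C ·U+Σ (r ∷ []) → r ≤ D ·U+Σ R → x ≤ C + D ·U+Σ R
  _▹_ {x} {r} {C} {D} {R} (within h) (within k) = within (begin
    x                       ≤⟨ h ⟩
    C * U + r               ≤⟨ +-monoʳ-≤ (C * U) k ⟩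
    C * U + (D * U + ∑ R)   ≡⟨ sym (+-assoc (C * U) (D * U) (∑ R)) ⟩
    C * U + D * U + ∑ R     ≡⟨ cong (_+ ∑ R) (sym (*-distribʳ-+ U C D)) ⟩
    (C + D) * U + ∑ R       ∎)
    where open ≤-Reasoning

  settle : ∀ K {x C R} → x ≤ C ·U+Σ R → C ≤ K → x ≤ K * U + ∑ R
  settle K {R = R} (within h) C≤K = ≤-trans h (+-monoˡ-≤ (∑ R) (*-monoˡ-≤ U C≤K))

  linear : ∀ K s r {x C R} → 1 ≤ s → C ≤ K → x ≤ C ·U+Σ R → ∑ R ≤ K * r * U →
           x ≤ K * (s + r) * U
  linear K s r {x} {C} {R} 1≤s C≤K (within h) hR = begin
    x                       ≤⟨ h ⟩
    C * U + ∑ R             ≤⟨ +-mono-≤ (*-monoˡ-≤ U (≤-trans C≤K (m≤m*n K s {{>-nonZero 1≤s}}))) hR ⟩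
    K * s * U + K * r * U   ≡⟨ *-distrib-+-scaled K s r U ⟩
    K * (s + r) * U         ∎
    where open ≤-Reasoning

  constant : ∀ K s {x C} → 1 ≤ s → C ≤ K → x ≤ C ·U+Σ [] → x ≤ K * s * U
  constant K s 1≤s C≤K b =
    ≤-trans (linear K s 0 1≤s C≤K b z≤n) (≤-reflexive (cong (λ t → K * t * U) (+-identityʳ s)))

module _ {M} (1≤M : 1 ≤ M) where
  open Budget M 1≤M

  gSize-discard : ∀ A → size A ≤ M → gSize (discard A) ≤ 3 * size A * M
  gSize-discard (pos p) h = constant 3 1 ≤-refl decide≤ (sequent (unit h ⊕ free) one)
  gSize-discard (neg p) h = constant 3 3 (s≤s z≤n) decide≤ (sequent (unit h ⊕ free) one)
  gSize-discard (A ∧ₙ B) h =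
    linear 3 1 (size A + size B) ≤-refl decide≤
      (sequent (unit h ⊕ free) one ⊕ residual (gSize-discard A (left≤ h)))
      (*-monoˡ-≤ M (*-monoʳ-≤ 3 (m≤m+n (size A) (size B))))
  gSize-discard (A ∨ₙ B) h =
    linear 3 1 (size A + size B) ≤-refl decide≤
      (sequent (unit h ⊕ free) one ⊕
        (residual (gSize-discard A (left≤ h)) ⊕ residual (gSize-discard B (right≤ h))))
      (≤-reflexive (*-distrib-+-scaled 3 (size A) (size B) M))

  gSize-explode : ∀ A → size A ≤ M → gSize (explode A) ≤ 3 * size A * M
  gSize-explode (pos p) h = constant 3 1 ≤-refl decide≤ (sequent (one ⊕ free) (unit h))
  gSize-explode (neg p) h = constant 3 3 (s≤s z≤n) decide≤ (sequent (one ⊕ free) (unit h))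
  gSize-explode (A ∧ₙ B) h =
    linear 3 1 (size A + size B) ≤-refl decide≤
      (sequent (one ⊕ free) (unit h) ⊕
        (residual (gSize-explode A (left≤ h)) ⊕ residual (gSize-explode B (right≤ h))))
      (≤-reflexive (*-distrib-+-scaled 3 (size A) (size B) M))
  gSize-explode (A ∨ₙ B) h =
    linear 3 1 (size A + size B) ≤-refl decide≤
      (sequent (one ⊕ free) (unit h) ⊕ residual (gSize-explode A (left≤ h)))
      (*-monoˡ-≤ M (*-monoʳ-≤ 3 (m≤m+n (size A) (size B))))

  gSize-refute : ∀ A → size A ≤ M → size (dual A) ≤ M →
                 ∀ {Γ} (q : Γ ↭ ⟦ A ⟧ ∷ ⟦ dual A ⟧ ∷ []) → gSize (refute A q) ≤ 10 * size A * M
  gSize-refute (pos p) h hd q =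
    constant 10 1 ≤-refl decide≤
      (cast (seqSize-↭ nothing q) (sequent (one ⊕ unit hd ⊕ free) free) ⊕
        (sequent (one ⊕ free) one ⊕ sequent (one ⊕ free) free))
  gSize-refute (neg p) h hd q =
    constant 10 3 (s≤s z≤n) decide≤
      (cast (seqSize-↭ nothing q) (sequent (unit h ⊕ one ⊕ free) free) ⊕
        (sequent (one ⊕ free) one ⊕ sequent (one ⊕ free) free))
  gSize-refute (A ∧ₙ B) h hd q =
    linear 10 1 (size A + size B) ≤-refl decide≤
      (cast (seqSize-↭ nothing q) (sequent (unit h ⊕ unit hd ⊕ free) free) ⊕
        ((sequent (unit (left≤ hd) ⊕ unit h ⊕ free) free ⊕
            residual (gSize-refute A (left≤ h) (left≤ hd) refl)) ⊕
         (sequent (unit (right≤ hd) ⊕ unit h ⊕ free) free ⊕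
            residual (gSize-refute B (right≤ h) (right≤ hd) refl))))
      (≤-reflexive (*-distrib-+-scaled 10 (size A) (size B) M))
  gSize-refute (A ∨ₙ B) h hd q =
    linear 10 1 (size A + size B) ≤-refl decide≤
      (cast (seqSize-↭ nothing q) (sequent (unit h ⊕ unit hd ⊕ free) free) ⊕
        ((sequent (unit (left≤ h) ⊕ unit hd ⊕ free) free ⊕
            residual (gSize-refute A (left≤ h) (left≤ hd) (swap _ _ refl))) ⊕
         (sequent (unit (right≤ h) ⊕ unit hd ⊕ free) free ⊕
            residual (gSize-refute B (right≤ h) (right≤ hd) (swap _ _ refl)))))
      (≤-reflexive (*-distrib-+-scaled 10 (size A) (size B) M))

  gSize-∨-comm : ∀ {X Y} → fsize X ≤ M → fsize Y ≤ M → (σ : G [] (just (X ⊔ Y))) →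
                 gSize (∨-comm σ) ≤ 27 * M + gSize σ
  gSize-∨-comm {X} {Y} hX hY σ =
    settle 27
      (sequent free ∣Y⊔X∣ ⊕ residual ≤-refl ⊕ sequent (∣X⊔Y∣ ⊕ free) ∣Y⊔X∣ ⊕
        ((sequent (∣X∣ ⊕ free) ∣Y⊔X∣ ⊕ sequent (∣X∣ ⊕ free) ∣X∣) ⊕
         (sequent (∣Y∣ ⊕ free) ∣Y⊔X∣ ⊕ sequent (∣Y∣ ⊕ free) ∣Y∣)))
      decide≤
    where
    ∣X∣ : fsize X ≤ 1 ·U+Σ []
    ∣X∣ = unit hX
    ∣Y∣ : fsize Y ≤ 1 ·U+Σ []
    ∣Y∣ = unit hY
    ∣X⊔Y∣ : fsize (X ⊔ Y) ≤ 3 ·U+Σ []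
    ∣X⊔Y∣ = suc⊕ (∣X∣ ⊕ ∣Y∣)
    ∣Y⊔X∣ : fsize (Y ⊔ X) ≤ 3 ·U+Σ []
    ∣Y⊔X∣ = suc⊕ (∣Y∣ ⊕ ∣X∣)

module _ {M} (1≤M : 1 ≤ M) where
  private
    1≤M*M : 1 ≤ M * M
    1≤M*M = ≤-trans 1≤M (M≤M*M 1≤M)

  open Budget (M * M) 1≤M*M

  private
    bounded : ∀ {x} → x ≤ M → x ≤ 1 ·U+Σ []
    bounded h = unit (≤-trans h (M≤M*M 1≤M))

    discarding : ∀ {X} → size X ≤ M → gSize (discard X) ≤ 3 ·U+Σ []
    discarding {X} h = units (≤-trans (gSize-discard 1≤M X h) (*-≤-square 3 h))

    commuting : ∀ {X Y} → size X ≤ M → size Y ≤ M → (σ : G [] (just ⟦ X ∨ₙ Y ⟧)) →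
                gSize (∨-comm σ) ≤ 27 ·U+Σ (gSize σ ∷ [])
    commuting hX hY σ =
      within (gSize-∨-comm 1≤M*M (≤-trans hX (M≤M*M 1≤M)) (≤-trans hY (M≤M*M 1≤M)) σ)

  gSize-distrib : ∀ A A′ B B′ → size A ≤ M → size A′ ≤ M → size B ≤ M → size B′ ≤ M →
                  (σ : G [] (just ⟦ A ∨ₙ A′ ⟧)) (τ : G [] (just ⟦ B ∨ₙ B′ ⟧)) →
                  gSize (distrib A A′ B B′ σ τ) ≤ 180 * (M * M) + (gSize σ + gSize τ)
  gSize-distrib A A′ B B′ hA hA′ hB hB′ σ τ =
    settle 180
      (sequent free ∣T∣ ⊕ residual ≤-refl ⊕ sequent (∣A∨A′∣ ⊕ free) ∣T∣ ⊕ residual ≤-refl ⊕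
        sequent (∣B∨B′∣ ⊕ ∣A∨A′∣ ⊕ free) ∣T∣ ⊕ (fromB ⊕ fromB′))
      decide≤
    where
    ∣A∣ : size A ≤ 1 ·U+Σ []
    ∣A∣ = bounded hA
    ∣A′∣ : size A′ ≤ 1 ·U+Σ []
    ∣A′∣ = bounded hA′
    ∣B∣ : size B ≤ 1 ·U+Σ []
    ∣B∣ = bounded hB
    ∣B′∣ : size B′ ≤ 1 ·U+Σ []
    ∣B′∣ = bounded hB′
    ∣A∨A′∣ : size (A ∨ₙ A′) ≤ 3 ·U+Σ []
    ∣A∨A′∣ = suc⊕ (∣A∣ ⊕ ∣A′∣)
    ∣B∨B′∣ : size (B ∨ₙ B′) ≤ 3 ·U+Σ []
    ∣B∨B′∣ = suc⊕ (∣B∣ ⊕ ∣B′∣)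
    ∣A∧B∣ : size (A ∧ₙ B) ≤ 3 ·U+Σ []
    ∣A∧B∣ = suc⊕ (∣A∣ ⊕ ∣B∣)
    ∣A′∨B′∣ : size (A′ ∨ₙ B′) ≤ 3 ·U+Σ []
    ∣A′∨B′∣ = suc⊕ (∣A′∣ ⊕ ∣B′∣)
    ∣T∣ : size ((A ∧ₙ B) ∨ₙ (A′ ∨ₙ B′)) ≤ 7 ·U+Σ []
    ∣T∣ = suc⊕ (∣A∧B∣ ⊕ ∣A′∨B′∣)
    fromB =
      sequent (∣B∣ ⊕ ∣A∨A′∣ ⊕ free) ∣T∣ ⊕
        ((sequent (∣A∣ ⊕ ∣B∣ ⊕ free) ∣T∣ ⊕ sequent (∣A∣ ⊕ ∣B∣ ⊕ free) ∣A∧B∣ ⊕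
           ((sequent (∣A∣ ⊕ ∣B∣ ⊕ free) ∣A∣ ⊕ discarding hB ⊕
               sequent (one ⊕ ∣A∣ ⊕ free) ∣A∣ ⊕ sequent (∣A∣ ⊕ free) ∣A∣) ⊕
            (sequent (∣A∣ ⊕ ∣B∣ ⊕ free) ∣B∣ ⊕ discarding hA ⊕
               sequent (one ⊕ ∣B∣ ⊕ free) ∣B∣ ⊕ sequent (∣B∣ ⊕ free) ∣B∣))) ⊕
         (sequent (∣A′∣ ⊕ ∣B∣ ⊕ free) ∣T∣ ⊕ discarding hB ⊕
            sequent (one ⊕ ∣A′∣ ⊕ free) ∣T∣ ⊕ sequent (∣A′∣ ⊕ free) ∣T∣ ⊕
            sequent (∣A′∣ ⊕ free) ∣A′∨B′∣ ⊕ sequent (∣A′∣ ⊕ free) ∣A′∣))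
    fromB′ =
      sequent (∣B′∣ ⊕ ∣A∨A′∣ ⊕ free) ∣T∣ ⊕
        (sequent (∣A∨A′∣ ⊕ free) one ⊕ (discarding hA ⊕ discarding hA′)) ⊕
        sequent (one ⊕ ∣B′∣ ⊕ free) ∣T∣ ⊕ sequent (∣B′∣ ⊕ free) ∣T∣ ⊕
        sequent (∣B′∣ ⊕ free) ∣A′∨B′∣ ⊕ sequent (∣B′∣ ⊕ free) ∣B′∣

  gSize-excludedMiddle : ∀ A → size A ≤ M → size (dual A) ≤ M →
                         gSize (excludedMiddle A) ≤ 300 * size A * (M * M)
  gSize-excludedMiddle (pos p) h hd =
    constant 300 1 ≤-refl decide≤ (sequent free (suc⊕ (bounded h ⊕ bounded hd)))
  gSize-excludedMiddle (neg p) h hd =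
    constant 300 3 (s≤s z≤n) decide≤
      (commuting hd h (em p) ▹ sequent free (suc⊕ (bounded hd ⊕ bounded h)))
  gSize-excludedMiddle (A ∧ₙ B) h hd =
    linear 300 1 (size A + size B) ≤-refl decide≤
      (within {C = 180}
         (gSize-distrib A (dual A) B (dual B) (left≤ h) (left≤ hd) (right≤ h) (right≤ hd)
           (excludedMiddle A) (excludedMiddle B)) ▹
        (residual (gSize-excludedMiddle A (left≤ h) (left≤ hd)) ⊕
         residual (gSize-excludedMiddle B (right≤ h) (right≤ hd))))
      (≤-reflexive (*-distrib-+-scaled 300 (size A) (size B) (M * M)))
  gSize-excludedMiddle (A ∨ₙ B) h hd =
    linear 300 1 (size A + size B) ≤-refl decide≤
      (commuting hd h (distrib _ _ _ _ σ τ) ▹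
        within {C = 180}
          (gSize-distrib (dual A) A (dual B) B (left≤ hd) (left≤ h) (right≤ hd) (right≤ h) σ τ) ▹
        ((commuting (left≤ h) (left≤ hd) (excludedMiddle A) ▹
            residual (gSize-excludedMiddle A (left≤ h) (left≤ hd))) ⊕
         (commuting (right≤ h) (right≤ hd) (excludedMiddle B) ▹
            residual (gSize-excludedMiddle B (right≤ h) (right≤ hd)))))
      (≤-reflexive (*-distrib-+-scaled 300 (size A) (size B) (M * M)))
    where
    σ : G [] (just ⟦ dual A ∨ₙ A ⟧)
    σ = ∨-comm (excludedMiddle A)
    τ : G [] (just ⟦ dual B ∨ₙ B ⟧)
    τ = ∨-comm (excludedMiddle B)

module _ {M} (1≤M : 1 ≤ M) where
  private
    M*M≤M*[M*M] : M * M ≤ M * (M * M)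
    M*M≤M*[M*M] = *-monoʳ-≤ M (M≤M*M 1≤M)

    M≤M*[M*M] : M ≤ M * (M * M)
    M≤M*[M*M] = ≤-trans (M≤M*M 1≤M) M*M≤M*[M*M]

  open Budget (M * (M * M)) (≤-trans 1≤M M≤M*[M*M])

  private
    bounded : ∀ {x} → x ≤ M → x ≤ 1 ·U+Σ []
    bounded h = unit (≤-trans h M≤M*[M*M])

    quadratic : ∀ K {x a} → x ≤ K * a * M → a ≤ M → x ≤ K ·U+Σ []
    quadratic K hx ha = units (≤-trans hx (≤-trans (*-≤-square K ha) (*-monoʳ-≤ K M*M≤M*[M*M])))

  gSize-duplicate : ∀ A → size A ≤ M → gSize (duplicate A) ≤ 2800 * (M * (M * M))
  gSize-duplicate A h =
    constant 2800 1 ≤-refl decide≤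
      (sequent (∣A∣ ⊕ free) ∣A⊗A∣ ⊕ excludedMiddle-cost ⊕ sequent (∣A∨dA∣ ⊕ ∣A∣ ⊕ free) ∣A⊗A∣ ⊕
        ((sequent (∣A∣ ⊕ ∣A∣ ⊕ free) ∣A⊗A∣ ⊕ (sequent (∣A∣ ⊕ free) ∣A∣ ⊕ sequent (∣A∣ ⊕ free) ∣A∣)) ⊕
         (sequent (∣dA∣ ⊕ ∣A∣ ⊕ free) ∣A⊗A∣ ⊕
           ((sequent (∣dA∣ ⊕ ∣A∣ ⊕ free) one ⊕ refute-cost) ⊕
            sequent (one ⊕ free) ∣A⊗A∣ ⊕ sequent (one ⊕ free) ∣𝟘⊗𝟘∣ ⊕
            sequent (∣𝟘⊗𝟘∣ ⊕ free) ∣A⊗A∣ ⊕ sequent (one ⊕ one ⊕ free) ∣A⊗A∣ ⊕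
            (explode-cost ⊕ explode-cost)))))
    where
    3M : ℕ
    3M = 3 * M
    1≤3M : 1 ≤ 3M
    1≤3M = ≤-trans 1≤M (m≤n*m M 3)
    h₃ : size A ≤ 3M
    h₃ = ≤-trans h (m≤n*m M 3)
    hd₃ : size (dual A) ≤ 3M
    hd₃ = ≤-trans (size-dual≤ A) (*-monoʳ-≤ 3 h)
    ∣A∣ : size A ≤ 1 ·U+Σ []
    ∣A∣ = bounded h
    ∣dA∣ : size (dual A) ≤ 3 ·U+Σ []
    ∣dA∣ = units (≤-trans hd₃ (*-monoʳ-≤ 3 M≤M*[M*M]))
    ∣A⊗A∣ : fsize (⟦ A ⟧ ⊗ ⟦ A ⟧) ≤ 3 ·U+Σ []
    ∣A⊗A∣ = suc⊕ (∣A∣ ⊕ ∣A∣)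
    ∣A∨dA∣ : size (A ∨ₙ dual A) ≤ 5 ·U+Σ []
    ∣A∨dA∣ = suc⊕ (∣A∣ ⊕ ∣dA∣)
    ∣𝟘⊗𝟘∣ : fsize (𝟘 ⊗ 𝟘) ≤ 3 ·U+Σ []
    ∣𝟘⊗𝟘∣ = suc⊕ (one ⊕ one)
    excludedMiddle-cost : gSize (excludedMiddle A) ≤ 2700 ·U+Σ []
    excludedMiddle-cost = units (begin
      gSize (excludedMiddle A)           ≤⟨ gSize-excludedMiddle 1≤3M A h₃ hd₃ ⟩
      300 * size A * (3M * 3M)           ≤⟨ *-monoˡ-≤ (3M * 3M) (*-monoʳ-≤ 300 h) ⟩
      300 * M * (3 * M * (3 * M))        ≡⟨ solve (M ∷ []) ⟩
      2700 * (M * (M * M))               ∎)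
      where open ≤-Reasoning
    refute-cost : gSize (refute A (swap _ _ refl)) ≤ 30 ·U+Σ []
    refute-cost = units (begin
      gSize (refute A (swap _ _ refl))   ≤⟨ gSize-refute 1≤3M A h₃ hd₃ (swap _ _ refl) ⟩
      10 * size A * 3M                   ≤⟨ *-monoˡ-≤ 3M (*-monoʳ-≤ 10 h) ⟩
      10 * M * (3 * M)                   ≡⟨ solve (M ∷ []) ⟩
      30 * (M * M)                       ≤⟨ *-monoʳ-≤ 30 M*M≤M*[M*M] ⟩
      30 * (M * (M * M))                 ∎)
      where open ≤-Reasoning
    explode-cost : gSize (explode A) ≤ 3 ·U+Σ []
    explode-cost = quadratic 3 (gSize-explode 1≤M A h) h

  private
    direct₁ : ∀ s p {g} → 1 ≤ s → s + p ≤ M → (p ≤ M → g ≤ 2803 * p * (M * (M * M))) →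
              s + g ≤ 2803 * (s + p) * (M * (M * M))
    direct₁ s p 1≤s h premise =
      linear 2803 s p 1≤s decide≤
        (bounded (m+n≤o⇒m≤o s h) ⊕ residual (premise (m+n≤o⇒n≤o s h))) ≤-refl

    direct₂ : ∀ s p r {g k} → 1 ≤ s → s + (p + r) ≤ M →
              (p ≤ M → g ≤ 2803 * p * (M * (M * M))) → (r ≤ M → k ≤ 2803 * r * (M * (M * M))) →
              s + (g + k) ≤ 2803 * (s + (p + r)) * (M * (M * M))
    direct₂ s p r 1≤s h premise₁ premise₂ =
      linear 2803 s (p + r) 1≤s decide≤
        (bounded (m+n≤o⇒m≤o s h) ⊕
          (residual (premise₁ (m+n≤o⇒m≤o p hpr)) ⊕ residual (premise₂ (m+n≤o⇒n≤o p hpr))))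
        (≤-reflexive (*-distrib-+-scaled 2803 p r (M * (M * M))))
      where
      hpr : p + r ≤ M
      hpr = m+n≤o⇒n≤o s h

  gSize-translate : ∀ {Γ Δ} (π : LK Γ Δ) → lkSize π ≤ M →
                    gSize (translate π) ≤ 2803 * lkSize π * (M * (M * M))
  gSize-translate {Γ} {Δ} (ax-p p) h = constant 2803 (nseqSize Γ Δ) (s≤s z≤n) decide≤ (bounded h)
  gSize-translate {Γ} {Δ} (ax-n p) h = constant 2803 (nseqSize Γ Δ) (s≤s z≤n) decide≤ (bounded h)
  gSize-translate {Γ} {Δ} (ax-em p) h = constant 2803 (nseqSize Γ Δ) (s≤s z≤n) decide≤ (bounded h)
  gSize-translate {Γ} {Δ} (ax-pn p q) h =
    constant 2803 (nseqSize Γ Δ) (s≤s z≤n) decide≤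
      (bounded h ⊕ (sequent (one ⊕ free) one ⊕ sequent (one ⊕ free) free))
  gSize-translate {Γ} {Δ} (wL A π q) h =
    linear 2803 (nseqSize Γ Δ) (lkSize π) (s≤s z≤n) decide≤
      (bounded hs ⊕ quadratic 3 (gSize-discard 1≤M A hA) hA ⊕
        bounded (≤-trans (seqSize-𝟙 (Maybe.map ⟦_⟧ Δ) (map⁺ ⟦_⟧ q)) hs) ⊕
        residual (gSize-translate π (m+n≤o⇒n≤o (nseqSize Γ Δ) h)))
      ≤-refl
    where
    hs : nseqSize Γ Δ ≤ M
    hs = m+n≤o⇒m≤o (nseqSize Γ Δ) h
    hA : size A ≤ M
    hA = ≤-trans (fsize≤seqSizeˡ (Maybe.map ⟦_⟧ Δ) (map⁺ ⟦_⟧ q)) hs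
  gSize-translate {Γ} {just A} (wR A π) h =
    linear 2803 (nseqSize Γ (just A)) (lkSize π) (s≤s z≤n) decide≤
      (bounded hs ⊕
        ((bounded (≤-trans (seqSize-𝟘 (map ⟦_⟧ Γ) ⟦ A ⟧) hs) ⊕
           residual (gSize-translate π (m+n≤o⇒n≤o (nseqSize Γ (just A)) h))) ⊕
         quadratic 3 (gSize-explode 1≤M A hA) hA))
      ≤-refl
    where
    hs : nseqSize Γ (just A) ≤ M
    hs = m+n≤o⇒m≤o (nseqSize Γ (just A)) h
    hA : size A ≤ M
    hA = ≤-trans (fsize≤seqSizeʳ (map ⟦_⟧ Γ) ⟦ A ⟧) hs
  gSize-translate {Γ} {Δ} (cL {Σ = Σ′} A π q) h =
    linear 2803 (nseqSize Γ Δ) (lkSize π) (s≤s z≤n) decide≤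
      (bounded hs ⊕ units {C = 2800} (gSize-duplicate A hA) ⊕
        cast (seqSize-⊗ ⟦ A ⟧ ⟦ A ⟧ (map ⟦_⟧ Σ′) (Maybe.map ⟦_⟧ Δ))
          (suc⊕ (bounded (≤-trans (nseqSize≤lkSize π) hπ))) ⊕
        residual (gSize-translate π hπ))
      ≤-refl
    where
    hs : nseqSize Γ Δ ≤ M
    hs = m+n≤o⇒m≤o (nseqSize Γ Δ) h
    hπ : lkSize π ≤ M
    hπ = m+n≤o⇒n≤o (nseqSize Γ Δ) h
    hA : size A ≤ M
    hA = ≤-trans (fsize≤seqSizeˡ (Maybe.map ⟦_⟧ Δ) (map⁺ ⟦_⟧ q)) hs
  gSize-translate {Γ} {Δ} (cut A π ρ q) h =
    direct₂ (nseqSize Γ Δ) (lkSize π) (lkSize ρ) (s≤s z≤n) h (gSize-translate π) (gSize-translate ρ)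
  gSize-translate {Γ} {Δ} (∧L₁ A B π q) h =
    direct₁ (nseqSize Γ Δ) (lkSize π) (s≤s z≤n) h (gSize-translate π)
  gSize-translate {Γ} {Δ} (∧L₂ A B π q) h =
    direct₁ (nseqSize Γ Δ) (lkSize π) (s≤s z≤n) h (gSize-translate π)
  gSize-translate {Γ} {Δ} (∧R A B π ρ) h =
    direct₂ (nseqSize Γ Δ) (lkSize π) (lkSize ρ) (s≤s z≤n) h (gSize-translate π) (gSize-translate ρ)
  gSize-translate {Γ} {Δ} (∨L A B π ρ q) h =
    direct₂ (nseqSize Γ Δ) (lkSize π) (lkSize ρ) (s≤s z≤n) h (gSize-translate π) (gSize-translate ρ)
  gSize-translate {Γ} {Δ} (∨R₁ A B π) h =
    direct₁ (nseqSize Γ Δ) (lkSize π) (s≤s z≤n) h (gSize-translate π)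
  gSize-translate {Γ} {Δ} (∨R₂ A B π) h =
    direct₁ (nseqSize Γ Δ) (lkSize π) (s≤s z≤n) h (gSize-translate π)

gSize-translate≤ : ∀ {Γ Δ} (π : LK Γ Δ) → gSize (translate π) ≤ 2803 * lkSize π ^ 2803
gSize-translate≤ π =
  ≤-trans (gSize-translate 1≤L π ≤-refl) (quartic≤power 2803 (lkSize π) 1≤L decide≤)
  where
  1≤L : 1 ≤ lkSize π
  1≤L = ≤-trans (s≤s z≤n) (nseqSize≤lkSize π)

lemma36 : Σ ℕ λ c → ∀ {Γ Δ} (π : LK Γ Δ) →
            Σ (G (map ⟦_⟧ Γ) (Maybe.map ⟦_⟧ Δ)) λ σ → gSize σ ≤ c * lkSize π ^ c
lemma36 = 2803 , λ π → translate π , gSize-translate≤ π
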